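{- Let $\mathbb{F}$ be an arbitrary field and $P\in\mathbb{F}[x_1,\ldots,x_n]$ an arbitrary polynomial. Let $\mathcal{F}\subseteq\mathbb{F}^n$ be a finite subset with $\mathcal{F}\ne\mathbb{F}^n$, let $h\in\mathbb{F}^n\setminus\mathcal{F}$, and put $\mathcal{T}=\mathcal{F}\cup\{h\}$. Suppose that $P(h)\neq 0$ and $P(f)=0$ for each $f\in\mathcal{F}$. Let $y\in \mathrm{Sm}(\prec_{deg},\mathcal{T})\setminus\mathrm{Sm}(\prec_{deg},\mathcal{F})$. Then $\deg(P)\ge\deg(y)$.
   Context: For monomials $u=x_1^{i_1}\cdots x_n^{i_n}$, $v=x_1^{j_1}\cdots x_n^{j_n}$: $u\prec_{lex}v$ iff $i_k<j_k$ for the smallest index $k$ with $i_k\ne j_k$; the deglex order $\prec_{deg}$ is defined by $u\prec_{deg}v$ iff $\deg u<\deg v$, or $\deg u=\deg v$ and $u\prec_{lex}v$. For a finite nonempty $\mathcal{F}\subseteq\mathbb{F}^n$, $I(\mathcal{F})=\{f\in\mathbb{F}[x_1,\ldots,x_n]: f(v)=0\ \forall v\in\mathcal{F}\}$. A monomial is a standard monomial of an ideal $I$ with respect to a term order $\prec$ if it is not the leading monomial (the $\prec$-largest monomial with nonzero coefficient) of any nonzero $f\in I$; $\mathrm{Sm}(\prec,\mathcal{F})$ denotes the set of standard monomials of $I(\mathcal{F})$. -}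

module Defs where

open import Level using (Level; _⊔_; suc)
open import Algebra.Bundles using (CommutativeRing)
open import Data.Nat as ℕ using (ℕ; zero; _<_)
import Data.Nat.Properties as ℕP
open import Data.Vec using (Vec; []; _∷_)
import Data.Vec.Properties as VecP
open import Data.List using (List; []; _∷_)
open import Data.List.Relation.Unary.All using (All)
open import Data.Product using (Σ; _×_; _,_; ∃)
open import Data.Sum using (_⊎_)
open import Data.Empty using (⊥)
open import Relation.Nullary using (¬_; yes; no)
open import Relation.Binary.PropositionalEquality using (_≡_)

record Field (c ℓ : Level) : Set (Level.suc (c ⊔ ℓ)) where
  field
    commutativeRing : CommutativeRing c ℓ
  open CommutativeRing commutativeRing public
  field
    0≉1     : ¬ (0# ≈ 1#)
    inverse : ∀ x → ¬ (x ≈ 0#) → Σ Carrier λ y → (x * y) ≈ 1#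

Monomial : ℕ → Set
Monomial n = Vec ℕ n

deg : ∀ {n} → Monomial n → ℕ
deg []       = 0
deg (i ∷ is) = i ℕ.+ deg is

_≺lex_ : ∀ {n} → Monomial n → Monomial n → Set
[]       ≺lex []       = ⊥
(i ∷ is) ≺lex (j ∷ js) = (i < j) ⊎ (i ≡ j × is ≺lex js)

_≺deg_ : ∀ {n} → Monomial n → Monomial n → Set
u ≺deg v = (deg u < deg v) ⊎ (deg u ≡ deg v × u ≺lex v)

module Poly {c ℓ} (𝔽 : Field c ℓ) where
  open Field 𝔽 public

  -- A polynomial in F[x₁,…,xₙ], represented as a finite formal sum of terms c·x^m.
  Poly : ℕ → Set c
  Poly n = List (Carrier × Monomial n)

  Point : ℕ → Set c
  Point n = Vec Carrier n

  coeff : ∀ {n} → Poly n → Monomial n → Carrier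
  coeff []             m = 0#
  coeff ((a , m') ∷ P) m with VecP.≡-dec ℕP._≟_ m' m
  ... | yes _ = a + coeff P m
  ... | no  _ = coeff P m

  _^_ : Carrier → ℕ → Carrier
  x ^ zero      = 1#
  x ^ ℕ.suc k   = x * (x ^ k)

  evalMon : ∀ {n} → Monomial n → Point n → Carrier
  evalMon []       []       = 1#
  evalMon (i ∷ is) (v ∷ vs) = (v ^ i) * evalMon is vs

  eval : ∀ {n} → Poly n → Point n → Carrier
  eval []            v = 0#
  eval ((a , m) ∷ P) v = (a * evalMon m v) + eval P v

  _≋_ : ∀ {n} → Point n → Point n → Set ℓ
  [] ≋ []             = Data.Unit.Polymorphic.⊤
    where import Data.Unit.Polymorphic
  (x ∷ xs) ≋ (y ∷ ys) = (x ≈ y) × (xs ≋ ys)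

  _∈I_ : ∀ {n} → Poly n → List (Point n) → Set (c ⊔ ℓ)
  f ∈I 𝓕 = All (λ v → eval f v ≈ 0#) 𝓕

  IsLeadingMonomial : ∀ {n} → Poly n → Monomial n → Set ℓ
  IsLeadingMonomial f m =
    ¬ (coeff f m ≈ 0#) × (∀ m' → ¬ (coeff f m' ≈ 0#) → (m' ≡ m) ⊎ (m' ≺deg m))

  IsStandard : ∀ {n} → List (Point n) → Monomial n → Set (c ⊔ ℓ)
  IsStandard 𝓕 m = ¬ (∃ λ f → (f ∈I 𝓕) × IsLeadingMonomial f m)

  HasDegree : ∀ {n} → Poly n → ℕ → Set ℓ
  HasDegree P d =
    (∃ λ m → ¬ (coeff P m ≈ 0#) × deg m ≡ d) × (∀ m → ¬ (coeff P m ≈ 0#) → deg m ℕ.≤ d)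

-- If deg P < deg y, then P involves only monomials ≺deg y. Take f ∈ I(𝓕)
-- with leading monomial y (y is not standard for 𝓕) and put
-- g = f − (f(h) / P(h)) · P. Then g vanishes on 𝓕 and at h, and subtracting
-- P, which lies entirely below y, does not disturb the leading monomial y of f.
-- So y is the leading monomial of some g ∈ I(𝓕 ∪ {h}), i.e. not standard for
-- 𝓕 ∪ {h}.
module Submission where

open import Defs
open import Data.Nat using (ℕ; _≤_; _<_; _≤?_; _<?_)
open import Data.Nat.Properties using (_≟_; <-irrefl; ≤-<-trans; ≰⇒>)
open import Data.List using (List; []; _∷_; _++_)
open import Data.List.Relation.Unary.All using (All; []; _∷_)
open import Data.Product using (_×_; _,_; ∃)
open import Data.Sum using (_⊎_; inj₁; inj₂)
open import Data.Vec using ([]; _∷_)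
import Data.Vec.Properties as Vec
open import Data.Empty using (⊥-elim)
open import Relation.Nullary using (¬_; Dec; yes; no)
open import Relation.Nullary.Decidable using (_⊎-dec_; _×-dec_)
open import Relation.Binary.PropositionalEquality using (_≡_; refl)
import Algebra.Properties.Ring as RingProperties

_≺lex?_ : ∀ {n} (u v : Monomial n) → Dec (u ≺lex v)
[]       ≺lex? []       = no λ ()
(i ∷ is) ≺lex? (j ∷ js) = (i <? j) ⊎-dec ((i ≟ j) ×-dec (is ≺lex? js))

_≺deg?_ : ∀ {n} (u v : Monomial n) → Dec (u ≺deg v)
u ≺deg? v = (deg u <? deg v) ⊎-dec ((deg u ≟ deg v) ×-dec (u ≺lex? v))

≺lex-irrefl : ∀ {n} (u : Monomial n) → ¬ (u ≺lex u)
≺lex-irrefl (i ∷ is) (inj₁ i<i)       = <-irrefl refl i<i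
≺lex-irrefl (i ∷ is) (inj₂ (_ , is≺is)) = ≺lex-irrefl is is≺is

≺deg-irrefl : ∀ {n} (u : Monomial n) → ¬ (u ≺deg u)
≺deg-irrefl u (inj₁ d<d)       = <-irrefl refl d<d
≺deg-irrefl u (inj₂ (_ , u≺u)) = ≺lex-irrefl u u≺u

module _ {c ℓ} (𝔽 : Field c ℓ) where
  open Poly 𝔽
  open RingProperties ring using (-‿distribˡ-*)
  open import Relation.Binary.Reasoning.Setoid setoid

  scale : ∀ {n} → Carrier → Poly n → Poly n
  scale k []            = []
  scale k ((a , m) ∷ P) = (k * a , m) ∷ scale k P

  _Below_ : ∀ {n} → Poly n → Monomial n → Set ℓ
  Q Below m = ∀ m′ → ¬ (coeff Q m′ ≈ 0#) → m′ ≺deg m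

  coeff-++ : ∀ {n} (A B : Poly n) m → coeff (A ++ B) m ≈ coeff A m + coeff B m
  coeff-++ []             B m = sym (+-identityˡ _)
  coeff-++ ((a , m′) ∷ A) B m with Vec.≡-dec _≟_ m′ m
  ... | yes _ = trans (+-congˡ (coeff-++ A B m)) (sym (+-assoc _ _ _))
  ... | no  _ = coeff-++ A B m

  coeff-scale : ∀ {n} k (A : Poly n) m → coeff (scale k A) m ≈ k * coeff A m
  coeff-scale k []             m = sym (zeroʳ k)
  coeff-scale k ((a , m′) ∷ A) m with Vec.≡-dec _≟_ m′ m
  ... | yes _ = trans (+-congˡ (coeff-scale k A m)) (sym (distribˡ _ _ _))
  ... | no  _ = coeff-scale k A m

  eval-++ : ∀ {n} (A B : Poly n) v → eval (A ++ B) v ≈ eval A v + eval B v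
  eval-++ []            B v = sym (+-identityˡ _)
  eval-++ ((a , m) ∷ A) B v = trans (+-congˡ (eval-++ A B v)) (sym (+-assoc _ _ _))

  eval-scale : ∀ {n} k (A : Poly n) v → eval (scale k A) v ≈ k * eval A v
  eval-scale k []            v = sym (zeroʳ k)
  eval-scale k ((a , m) ∷ A) v =
    trans (+-cong (*-assoc _ _ _) (eval-scale k A v)) (sym (distribˡ _ _ _))

  ≈0-+ : ∀ {a b} → a ≈ 0# → b ≈ 0# → a + b ≈ 0#
  ≈0-+ a≈0 b≈0 = trans (+-cong a≈0 b≈0) (+-identityˡ 0#)

  ≈0-* : ∀ k {a} → a ≈ 0# → k * a ≈ 0#
  ≈0-* k a≈0 = trans (*-congˡ a≈0) (zeroʳ k)

  ∈I-++ : ∀ {n} (A B : Poly n) {𝓕} → A ∈I 𝓕 → B ∈I 𝓕 → (A ++ B) ∈I 𝓕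
  ∈I-++ A B []             []             = []
  ∈I-++ A B (Av≈0 ∷ A∈I) (Bv≈0 ∷ B∈I) =
    trans (eval-++ A B _) (≈0-+ Av≈0 Bv≈0) ∷ ∈I-++ A B A∈I B∈I

  ∈I-scale : ∀ {n} k (A : Poly n) {𝓕} → A ∈I 𝓕 → scale k A ∈I 𝓕
  ∈I-scale k A []           = []
  ∈I-scale k A (Av≈0 ∷ A∈I) = trans (eval-scale k A _) (≈0-* k Av≈0) ∷ ∈I-scale k A A∈I

  below-scale : ∀ {n} k (Q : Poly n) {m} → Q Below m → scale k Q Below m
  below-scale k Q {m} Q<m m′ kQm′≉0 with m′ ≺deg? m
  ... | yes m′≺m = m′≺m
  ... | no  m′⊀m = ⊥-elim (m′⊀m (Q<m m′ λ Qm′≈0 →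
          kQm′≉0 (trans (coeff-scale k Q m′) (≈0-* k Qm′≈0))))

  below-of-degree : ∀ {n} (Q : Poly n) {d m} →
    (∀ m′ → ¬ (coeff Q m′ ≈ 0#) → deg m′ ≤ d) → d < deg m → Q Below m
  below-of-degree Q deg≤d d<m m′ Qm′≉0 = inj₁ (≤-<-trans (deg≤d m′ Qm′≉0) d<m)

  -- Equality of coefficients is not decidable, so "the coefficient vanishes"
  -- is only available doubly negated; this suffices since the goals are negative.
  leading-++-below : ∀ {n} (f Q : Poly n) {y} →
    IsLeadingMonomial f y → Q Below y → IsLeadingMonomial (f ++ Q) y
  leading-++-below f Q {y} (fy≉0 , f≼y) Q<y = f+Qy≉0 , f+Q≼y
    where
    f+Qy≉0 : ¬ (coeff (f ++ Q) y ≈ 0#)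
    f+Qy≉0 f+Qy≈0 = ≺deg-irrefl y (Q<y y λ Qy≈0 → fy≉0 (begin
      coeff f y              ≈⟨ sym (+-identityʳ _) ⟩
      coeff f y + 0#         ≈⟨ +-congˡ (sym Qy≈0) ⟩
      coeff f y + coeff Q y  ≈⟨ sym (coeff-++ f Q y) ⟩
      coeff (f ++ Q) y       ≈⟨ f+Qy≈0 ⟩
      0#                     ∎))

    f+Q≼y : ∀ m → ¬ (coeff (f ++ Q) m ≈ 0#) → (m ≡ y) ⊎ (m ≺deg y)
    f+Q≼y m f+Qm≉0 with Vec.≡-dec _≟_ m y | m ≺deg? y
    ... | yes m≡y | _        = inj₁ m≡y
    ... | no  _   | yes m≺y  = inj₂ m≺y
    ... | no  m≢y | no  m⊀y  =
      ⊥-elim (m⊀y (Q<y m λ Qm≈0 → not-above λ fm≈0 →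
        f+Qm≉0 (trans (coeff-++ f Q m) (≈0-+ fm≈0 Qm≈0))))
      where
      not-above : ¬ ¬ (coeff f m ≈ 0#)
      not-above fm≉0 with f≼y m fm≉0
      ... | inj₁ m≡y = m≢y m≡y
      ... | inj₂ m≺y = m⊀y m≺y

  cancel-by-inverse : ∀ a {b b⁻¹} → b * b⁻¹ ≈ 1# → a + - (a * b⁻¹) * b ≈ 0#
  cancel-by-inverse a {b} {b⁻¹} bb⁻¹≈1 = begin
    a + - (a * b⁻¹) * b    ≈⟨ +-congˡ (sym (-‿distribˡ-* _ _)) ⟩
    a + - ((a * b⁻¹) * b)  ≈⟨ +-congˡ (-‿cong (*-assoc _ _ _)) ⟩
    a + - (a * (b⁻¹ * b))  ≈⟨ +-congˡ (-‿cong (*-congˡ (trans (*-comm _ _) bb⁻¹≈1))) ⟩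
    a + - (a * 1#)         ≈⟨ +-congˡ (-‿cong (*-identityʳ a)) ⟩
    a + - a                ≈⟨ -‿inverseʳ a ⟩
    0#                     ∎

  leading-extends-to-point : ∀ {n} (f P : Poly n) {𝓕 h y} →
    ¬ (eval P h ≈ 0#) → P ∈I 𝓕 → P Below y →
    f ∈I 𝓕 → IsLeadingMonomial f y →
    ∃ λ g → (g ∈I (h ∷ 𝓕)) × IsLeadingMonomial g y
  leading-extends-to-point f P {h = h} Ph≉0 P∈I P<y f∈I f-lead
    with inverse (eval P h) Ph≉0
  ... | Ph⁻¹ , PhPh⁻¹≈1 =
    f ++ scale k P
    , gh≈0 ∷ ∈I-++ f (scale k P) f∈I (∈I-scale k P P∈I)
    , leading-++-below f (scale k P) f-lead (below-scale k P P<y)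
    where
    k : Carrier
    k = - (eval f h * Ph⁻¹)

    gh≈0 : eval (f ++ scale k P) h ≈ 0#
    gh≈0 = begin
      eval (f ++ scale k P) h          ≈⟨ eval-++ f (scale k P) h ⟩
      eval f h + eval (scale k P) h    ≈⟨ +-congˡ (eval-scale k P h) ⟩
      eval f h + k * eval P h          ≈⟨ cancel-by-inverse (eval f h) PhPh⁻¹≈1 ⟩
      0#                               ∎

theorem3p1 : ∀ {c ℓ} (𝔽 : Field c ℓ) (n : ℕ) →
    let open Poly 𝔽 in
    (P : Poly n) (𝓕 : List (Point n)) (h : Point n) →
    ¬ (𝓕 ≡ []) →
    All (λ f → ¬ (f ≋ h)) 𝓕 →
    ¬ (eval P h ≈ 0#) →
    P ∈I 𝓕 →
    (y : Monomial n) →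
    IsStandard (h ∷ 𝓕) y → ¬ IsStandard 𝓕 y →
    (d : ℕ) → HasDegree P d → deg y ≤ d
theorem3p1 𝔽 n P 𝓕 h _ _ Ph≉0 P∈I y y-std-T y-nonstd-F d (_ , P-deg≤d)
  with deg y ≤? d
... | yes y≤d = y≤d
... | no  y≰d = ⊥-elim (y-nonstd-F λ { (f , f∈I , f-lead) →
        y-std-T (leading-extends-to-point 𝔽 f P Ph≉0 P∈I
                   (below-of-degree 𝔽 P P-deg≤d (≰⇒> y≰d)) f∈I f-lead) })
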